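{- Let $V$ be a finite set and $d\ge0$ an integer. If $h:2^V\to\{0,1,\ldots,d\}$ is a monotone submodular set function, then there is a decision tree computing $h$ that has rank at most $d$.
   Context: $h$ is monotone if $h(S)\le h(T)$ for $S\subseteq T\subseteq V$, and submodular if $h(S\cup\{j\})-h(S)\ge h(T\cup\{j\})-h(T)$ for all $S\subseteq T\subseteq V$ and $j\in V\setminus T$. A decision tree over $V$ is a binary tree whose internal nodes are labeled by elements of $V$ and whose leaves are labeled by elements of $\{0,1,\ldots,d\}$; on input $S\subseteq V$, at an internal node labeled $x$ one goes to the right child if $x\in S$ and to the left child otherwise, and the output is the label of the leaf reached. The tree computes $h$ if its output on every $S\subseteq V$ is $h(S)$. The rank of a tree is defined recursively: a leaf has rank $0$; otherwise, if the left and right subtrees of the root have ranks $r_0$ and $r_1$, the rank is $\max\{r_0,r_1\}$ if $r_0\ne r_1$, and $r_0+1$ if $r_0=r_1$. -}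

module Defs where

open import Data.Nat using (ℕ; zero; suc; _≤_; _+_; _⊔_)
open import Data.Bool using (Bool; true; false)
open import Data.Fin using (Fin; toℕ)
open import Data.Fin.Subset using (Subset; _⊆_; _∈_; _∉_; _∪_; ⁅_⁆)
open import Data.Vec using (lookup)
open import Relation.Binary.PropositionalEquality using (_≡_)

-- Ground set V = Fin n (any finite set, up to relabelling);
-- subsets of V are  Subset n.  A set function h : 2^V → {0,…,d}
-- is a map  Subset n → Fin (suc d); values compared via toℕ.

Monotone : ∀ {n d} → (Subset n → Fin (suc d)) → Set
Monotone {n} h = ∀ (S T : Subset n) → S ⊆ T → toℕ (h S) ≤ toℕ (h T)

-- h(S ∪ {j}) - h(S) ≥ h(T ∪ {j}) - h(T), written additively
-- (the same inequality of integers):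
--   h(T ∪ {j}) + h(S) ≤ h(S ∪ {j}) + h(T).
Submodular : ∀ {n d} → (Subset n → Fin (suc d)) → Set
Submodular {n} h = ∀ (S T : Subset n) (j : Fin n) → S ⊆ T → j ∉ T →
  toℕ (h (T ∪ ⁅ j ⁆)) + toℕ (h S) ≤ toℕ (h (S ∪ ⁅ j ⁆)) + toℕ (h T)

data DTree (n d : ℕ) : Set where
  leaf : Fin (suc d) → DTree n d
  node : Fin n → DTree n d → DTree n d → DTree n d

eval : ∀ {n d} → DTree n d → Subset n → Fin (suc d)
eval (leaf v) S = v
eval (node x l r) S with lookup S x
... | true  = eval r S
... | false = eval l S

Computes : ∀ {n d} → DTree n d → (Subset n → Fin (suc d)) → Set
Computes {n} t h = ∀ (S : Subset n) → eval t S ≡ h S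

-- Rank: leaf 0; node: max if ranks differ, r+1 if equal.
rankNode : ℕ → ℕ → ℕ
rankNode zero    zero    = 1
rankNode zero    (suc b) = suc b
rankNode (suc a) zero    = suc a
rankNode (suc a) (suc b) = suc (rankNode a b)

rank : ∀ {n d} → DTree n d → ℕ
rank (leaf _)     = 0
rank (node _ l r) = rankNode (rank l) (rank r)

-- Split on the first element v of V. If adding v to the empty set does not raise h, then by
-- submodularity adding v never raises h, so h ignores v and the tree for the restriction to
-- V ∖ {v} computes h. Otherwise h{v} > h∅, and the two subtrees, for the restrictions to sets
-- without and with v, have ranks at most h(V ∖ {v}) − h∅ and h V − h{v} < h V − h∅ by
-- induction; a node joining them has rank at most the larger of the first and one more than
-- the second. Hence rank t ≤ h V − h∅ ≤ d.
module Submission where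

open import Defs
open import Data.Nat using (ℕ; zero; suc; _≤_; _+_; _⊔_; s≤s)
open import Data.Nat.Properties
  using (≤-refl; ≤-trans; ≤-antisym; n≤1+n; m≤m⊔n; m≤m+n; ⊔-lub; +-comm; +-suc;
         +-distribʳ-⊔; +-monoˡ-≤; +-monoʳ-≤; +-cancelʳ-≤; _≤?_; ≰⇒>)
open import Data.Bool using (true; false)
open import Data.Fin using (Fin; toℕ; zero; suc)
open import Data.Fin.Properties using (toℕ-injective; toℕ≤pred[n])
open import Data.Fin.Subset using (Subset; inside; outside; ⊥; ⊤; _∪_; ⁅_⁆; _∉_)
open import Data.Fin.Subset.Properties using (s⊆s; ⊥⊆; ⊆⊤; p⊆p∪q; drop-there; ∪-identityˡ; ∪-identityʳ)
open import Data.Vec using ([]; _∷_; lookup)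
open import Data.Product using (Σ; _×_; _,_)
open import Function using (_∘_)
open import Relation.Binary.PropositionalEquality using (_≡_; refl; sym; trans; cong; cong₂; subst)
open import Relation.Nullary using (yes; no)

module _ {n d : ℕ} (h : Subset (suc n) → Fin (suc d)) where

  Monotone-∷ : ∀ s → Monotone h → Monotone (λ X → h (s ∷ X))
  Monotone-∷ s mono S T S⊆T = mono (s ∷ S) (s ∷ T) (s⊆s S⊆T)

  Submodular-∷ : ∀ s → Submodular h → Submodular (λ X → h (s ∷ X))
  Submodular-∷ outside sub S T j S⊆T j∉T = sub _ _ (suc j) (s⊆s S⊆T) (j∉T ∘ drop-there)
  Submodular-∷ inside  sub S T j S⊆T j∉T = sub _ _ (suc j) (s⊆s S⊆T) (j∉T ∘ drop-there)

module _ {n d : ℕ} {h : Subset n → Fin (suc d)} (mono : Monotone h) (sub : Submodular h) where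

  -- Submodularity with S = ∅ bounds every marginal gain of j by the gain h ⁅ j ⁆ − h ⊥.
  null-element-irrelevant : (j : Fin n) → toℕ (h ⁅ j ⁆) ≤ toℕ (h ⊥) →
    ∀ X → j ∉ X → h (X ∪ ⁅ j ⁆) ≡ h X
  null-element-irrelevant j h⁅j⁆≤h⊥ X j∉X =
    toℕ-injective (≤-antisym gain≤0 (mono X (X ∪ ⁅ j ⁆) (p⊆p∪q ⁅ j ⁆)))
    where
    gain≤0 : toℕ (h (X ∪ ⁅ j ⁆)) ≤ toℕ (h X)
    gain≤0 = +-cancelʳ-≤ (toℕ (h ⊥)) _ _ (begin
      toℕ (h (X ∪ ⁅ j ⁆)) + toℕ (h ⊥)  ≤⟨ sub ⊥ X j ⊥⊆ j∉X ⟩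
      toℕ (h (⊥ ∪ ⁅ j ⁆)) + toℕ (h X)  ≡⟨ cong (λ Y → toℕ (h Y) + toℕ (h X)) (∪-identityˡ ⁅ j ⁆) ⟩
      toℕ (h ⁅ j ⁆) + toℕ (h X)        ≤⟨ +-monoˡ-≤ (toℕ (h X)) h⁅j⁆≤h⊥ ⟩
      toℕ (h ⊥) + toℕ (h X)            ≡⟨ +-comm (toℕ (h ⊥)) (toℕ (h X)) ⟩
      toℕ (h X) + toℕ (h ⊥)            ∎)
      where open Data.Nat.Properties.≤-Reasoning

lift : ∀ {n d} → DTree n d → DTree (suc n) d
lift (leaf v)     = leaf v
lift (node x l r) = node (suc x) (lift l) (lift r)

eval-lift : ∀ {n d} (t : DTree n d) s (X : Subset n) → eval (lift t) (s ∷ X) ≡ eval t X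
eval-lift (leaf v)     s X = refl
eval-lift (node x l r) s X with lookup X x
... | true  = eval-lift r s X
... | false = eval-lift l s X

rank-lift : ∀ {n d} (t : DTree n d) → rank (lift t) ≡ rank t
rank-lift (leaf v)     = refl
rank-lift (node x l r) = cong₂ rankNode (rank-lift l) (rank-lift r)

rankNode≤⊔suc : ∀ a b → rankNode a b ≤ a ⊔ suc b
rankNode≤⊔suc zero    zero    = ≤-refl
rankNode≤⊔suc zero    (suc b) = n≤1+n (suc b)
rankNode≤⊔suc (suc a) zero    = m≤m⊔n (suc a) 1
rankNode≤⊔suc (suc a) (suc b) = s≤s (rankNode≤⊔suc a b)

module _ {n d : ℕ} {h : Subset (suc n) → Fin (suc d)} where

  Computes-lift : ∀ t → Computes t (λ X → h (outside ∷ X)) →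
    (∀ X → h (inside ∷ X) ≡ h (outside ∷ X)) → Computes (lift t) h
  Computes-lift t ct h-ignores-zero (outside ∷ X) = trans (eval-lift t outside X) (ct X)
  Computes-lift t ct h-ignores-zero (inside  ∷ X) =
    trans (eval-lift t inside X) (trans (ct X) (sym (h-ignores-zero X)))

  Computes-node : ∀ t₀ t₁ → Computes t₀ (λ X → h (outside ∷ X)) →
    Computes t₁ (λ X → h (inside ∷ X)) → Computes (node zero (lift t₀) (lift t₁)) h
  Computes-node t₀ t₁ c₀ c₁ (outside ∷ X) = trans (eval-lift t₀ outside X) (c₀ X)
  Computes-node t₀ t₁ c₀ c₁ (inside ∷ X) = trans (eval-lift t₁ inside X) (c₁ X)

rank-node-bound : ∀ r₀ r₁ {a c m} → r₀ + a ≤ m → r₁ + c ≤ m → suc a ≤ c →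
  rankNode r₀ r₁ + a ≤ m
rank-node-bound r₀ r₁ {a} {c} {m} r₀+a≤m r₁+c≤m a<c = begin
  rankNode r₀ r₁ + a        ≤⟨ +-monoˡ-≤ a (rankNode≤⊔suc r₀ r₁) ⟩
  (r₀ ⊔ suc r₁) + a         ≡⟨ +-distribʳ-⊔ a r₀ (suc r₁) ⟩
  (r₀ + a) ⊔ (suc r₁ + a)   ≤⟨ ⊔-lub r₀+a≤m (≤-trans r₁+1+a≤r₁+c r₁+c≤m) ⟩
  m                         ∎
  where
  open Data.Nat.Properties.≤-Reasoning
  r₁+1+a≤r₁+c : suc r₁ + a ≤ r₁ + c
  r₁+1+a≤r₁+c = subst (_≤ r₁ + c) (+-suc r₁ a) (+-monoʳ-≤ r₁ a<c)

tree-with-rank+h⊥≤h⊤ : ∀ {d} n (h : Subset n → Fin (suc d)) → Monotone h → Submodular h →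
  Σ (DTree n d) (λ t → Computes t h × rank t + toℕ (h ⊥) ≤ toℕ (h ⊤))
tree-with-rank+h⊥≤h⊤ zero h mono sub = leaf (h ⊥) , (λ { [] → refl }) , ≤-refl
tree-with-rank+h⊥≤h⊤ (suc n) h mono sub
  with tree-with-rank+h⊥≤h⊤ n _ (Monotone-∷ h outside mono) (Submodular-∷ h outside sub)
     | tree-with-rank+h⊥≤h⊤ n _ (Monotone-∷ h inside mono) (Submodular-∷ h inside sub)
     | toℕ (h ⁅ zero ⁆) ≤? toℕ (h ⊥)
... | t₀ , c₀ , r₀ | _ , _ , _ | yes h⁅0⁆≤h⊥ =
  lift t₀ , Computes-lift t₀ c₀ h-ignores-zero ,
  subst (λ r → r + _ ≤ _) (sym (rank-lift t₀)) (≤-trans r₀ (mono (outside ∷ ⊤) ⊤ ⊆⊤))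
  where
  h-ignores-zero : ∀ X → h (inside ∷ X) ≡ h (outside ∷ X)
  h-ignores-zero X = trans (cong (λ Y → h (inside ∷ Y)) (sym (∪-identityʳ X)))
    (null-element-irrelevant mono sub zero h⁅0⁆≤h⊥ (outside ∷ X) λ ())
... | t₀ , c₀ , r₀ | t₁ , c₁ , r₁ | no h⁅0⁆≰h⊥ =
  node zero (lift t₀) (lift t₁) , Computes-node t₀ t₁ c₀ c₁ ,
  subst (λ r → r + _ ≤ _) (sym (cong₂ rankNode (rank-lift t₀) (rank-lift t₁)))
    (rank-node-bound (rank t₀) (rank t₁) (≤-trans r₀ (mono (outside ∷ ⊤) ⊤ ⊆⊤)) r₁ (≰⇒> h⁅0⁆≰h⊥))

lemma5 : (n d : ℕ) (h : Subset n → Fin (suc d)) →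
    Monotone h → Submodular h →
    Σ (DTree n d) (λ t → Computes t h × rank t ≤ d)
lemma5 n d h mono sub with tree-with-rank+h⊥≤h⊤ n h mono sub
... | t , computes , rank+h⊥≤h⊤ =
  t , computes , ≤-trans (m≤m+n (rank t) _) (≤-trans rank+h⊥≤h⊤ (toℕ≤pred[n] (h ⊤)))
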